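{- For all closed terms $P,Q\in\mathcal{SP}^{\mathsf U}_A$: $\mathrm{EqMFEL}^{\mathsf U}\vdash P=Q$ if and only if $\mathit{mfe}^{\mathsf U}(P)=\mathit{mfe}^{\mathsf U}(Q)$. (That is, the logic $\mathrm{MFEL}^{\mathsf U}$, defined by $\mathrm{MFEL}^{\mathsf U}\models P=Q\iff\mathit{mfe}^{\mathsf U}(P)=\mathit{mfe}^{\mathsf U}(Q)$, is axiomatised by $\mathrm{EqMFEL}^{\mathsf U}$.)
   Context: Let $A$ be a countable set of atoms. $\mathcal{SP}^{\mathsf U}_A$: closed terms generated by $P::=\mathsf T\mid\mathsf F\mid\mathsf U\mid a\mid \neg P\mid P\mathbin{\wedge_\bullet}P\mid P\mathbin{\vee_\bullet}P$ ($a\in A$). $\mathcal T^{\mathsf U}_A$: $\mathsf T,\mathsf F,\mathsf U\in\mathcal T^{\mathsf U}_A$ and $(X\trianglelefteq a\trianglerighteq Y)\in\mathcal T^{\mathsf U}_A$ for $X,Y\in\mathcal T^{\mathsf U}_A$, $a\in A$. Leaf replacement $X[\mathsf T\mapsto Y,\mathsf F\mapsto Z]$ replaces leaves $\mathsf T$ by $Y$ and $\mathsf F$ by $Z$ and leaves $\mathsf U$ unchanged; omitted replacements are identities. $\mathit{fe}^{\mathsf U}$: $\mathit{fe}^{\mathsf U}(B)=B$ ($B\in\{\mathsf T,\mathsf F,\mathsf U\}$), $\mathit{fe}^{\mathsf U}(a)=\mathsf T\trianglelefteq a\trianglerighteq\mathsf F$, $\mathit{fe}^{\mathsf U}(\neg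 P)=\mathit{fe}^{\mathsf U}(P)[\mathsf T\mapsto\mathsf F,\mathsf F\mapsto\mathsf T]$, $\mathit{fe}^{\mathsf U}(P\mathbin{\wedge_\bullet}Q)=\mathit{fe}^{\mathsf U}(P)[\mathsf T\mapsto\mathit{fe}^{\mathsf U}(Q),\mathsf F\mapsto\mathit{fe}^{\mathsf U}(Q)[\mathsf T\mapsto\mathsf F]]$, $\mathit{fe}^{\mathsf U}(P\mathbin{\vee_\bullet}Q)=\mathit{fe}^{\mathsf U}(P)[\mathsf T\mapsto\mathit{fe}^{\mathsf U}(Q)[\mathsf F\mapsto\mathsf T],\mathsf F\mapsto\mathit{fe}^{\mathsf U}(Q)]$. For $a\in A$: $L_a(B)=R_a(B)=B$ for leaves $B$; $L_a(X\trianglelefteq b\trianglerighteq Y)=L_a(X)$ if $b=a$, else $L_a(X)\trianglelefteq b\trianglerighteq L_a(Y)$; $R_a(X\trianglelefteq b\trianglerighteq Y)=R_a(Y)$ if $b=a$, else $R_a(X)\trianglelefteq b\trianglerighteq R_a(Y)$. $m(B)=B$ for leaves, $m(X\trianglelefteq a\trianglerighteq Y)=m(L_a(X))\trianglelefteq a\trianglerighteq m(R_a(Y))$. $\mathit{mfe}^{\mathsf U}(P)=m(\mathit{fe}^{\mathsf U}(P))$. $\mathrm{EqFFEL}$: $\mathsf F=\neg\mathsf T$; $x\mathbin{\vee_\bullet}y=\neg(\neg x\mathbin{\wedge_\bullet}\neg y)$; $\neg\neg x=x$; $(x\mathbin{\wedge_\bullet}y)\mathbin{\wedge_\bullet}z=x\mathbin{\wedge_\bullet}(y\mathbin{\wedge_\bullet}z)$;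 $\mathsf T\mathbin{\wedge_\bullet}x=x$; $x\mathbin{\wedge_\bullet}\mathsf T=x$; $x\mathbin{\wedge_\bullet}\mathsf F=\mathsf F\mathbin{\wedge_\bullet}x$; $\neg x\mathbin{\wedge_\bullet}\mathsf F=x\mathbin{\wedge_\bullet}\mathsf F$; $(x\mathbin{\wedge_\bullet}\mathsf F)\mathbin{\vee_\bullet}y=(x\mathbin{\vee_\bullet}\mathsf T)\mathbin{\wedge_\bullet}y$; $x\mathbin{\vee_\bullet}(y\mathbin{\wedge_\bullet}\mathsf F)=x\mathbin{\wedge_\bullet}(y\mathbin{\vee_\bullet}\mathsf T)$. $\mathrm{EqMFEL}^{\mathsf U}=\mathrm{EqFFEL}\cup\{(x\mathbin{\vee_\bullet}y)\mathbin{\wedge_\bullet}z=(\neg x\mathbin{\wedge_\bullet}(y\mathbin{\wedge_\bullet}z))\mathbin{\vee_\bullet}(x\mathbin{\wedge_\bullet}z),\ \neg\mathsf U=\mathsf U,\ \mathsf U\mathbin{\wedge_\bullet}x=\mathsf U\}$. $\vdash$ is derivability in equational logic. -}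

module Defs where

open import Data.Nat using (ℕ; _⊔_)
open import Data.Empty using (⊥)
open import Data.Fin using (Fin; zero; suc)
open import Relation.Binary.PropositionalEquality using (_≡_)
open import Relation.Nullary using (Dec; yes; no)
open import Relation.Binary.Definitions using (DecidableEquality)
open import Function.Definitions using (Injective)

-- Atoms: a type A with decidable equality (needed to compare atoms in
-- L_a, R_a) and an injection into ℕ (countability).
record Atoms : Set₁ where
  field
    Atom   : Set
    _≟A_   : DecidableEquality Atom
    enc    : Atom → ℕ
    enc-inj : Injective _≡_ _≡_ enc

module _ (𝔸 : Atoms) where
  open Atoms 𝔸

  data Term (V : Set) : Set where
    var  : V → Term V
    `T `F `U : Term V
    atom : Atom → Term V
    `¬_  : Term V → Term V
    _∧•_ : Term V → Term V → Term V
    _∨•_ : Term V → Term V → Term V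

  infixr 7 _∧•_
  infixr 6 _∨•_
  infix 8 `¬_

  SP : Set
  SP = Term ⊥

  subst : ∀ {V W} → (V → Term W) → Term V → Term W
  subst σ (var x) = σ x
  subst σ `T = `T
  subst σ `F = `F
  subst σ `U = `U
  subst σ (atom a) = atom a
  subst σ (`¬ p) = `¬ subst σ p
  subst σ (p ∧• q) = subst σ p ∧• subst σ q
  subst σ (p ∨• q) = subst σ p ∨• subst σ q

  x y z : Term (Fin 3)
  x = var zero
  y = var (suc zero)
  z = var (suc (suc zero))

  data Axiom : Term (Fin 3) → Term (Fin 3) → Set where
    F1  : Axiom `F (`¬ `T)
    F2  : Axiom (x ∨• y) (`¬ ((`¬ x) ∧• (`¬ y)))
    F3  : Axiom (`¬ (`¬ x)) x
    F4  : Axiom ((x ∧• y) ∧• z) (x ∧• (y ∧• z))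
    F5  : Axiom (`T ∧• x) x
    F6  : Axiom (x ∧• `T) x
    F7  : Axiom (x ∧• `F) (`F ∧• x)
    F8  : Axiom ((`¬ x) ∧• `F) (x ∧• `F)
    F9  : Axiom ((x ∧• `F) ∨• y) ((x ∨• `T) ∧• y)
    F10 : Axiom (x ∨• (y ∧• `F)) (x ∧• (y ∨• `T))
    M1  : Axiom ((x ∨• y) ∧• z) (((`¬ x) ∧• (y ∧• z)) ∨• (x ∧• z))
    U1  : Axiom (`¬ `U) `U
    U2  : Axiom (`U ∧• x) `U

  infix 4 _⊢_≈_
  data _⊢_≈_ (V : Set) : Term V → Term V → Set where
    ax    : ∀ {l r} → Axiom l r → (σ : Fin 3 → Term V) → V ⊢ subst σ l ≈ subst σ r
    refl≈ : ∀ {p} → V ⊢ p ≈ p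
    sym≈  : ∀ {p q} → V ⊢ p ≈ q → V ⊢ q ≈ p
    trans≈ : ∀ {p q r} → V ⊢ p ≈ q → V ⊢ q ≈ r → V ⊢ p ≈ r
    cong¬ : ∀ {p q} → V ⊢ p ≈ q → V ⊢ (`¬ p) ≈ (`¬ q)
    cong∧ : ∀ {p p' q q'} → V ⊢ p ≈ p' → V ⊢ q ≈ q' → V ⊢ (p ∧• q) ≈ (p' ∧• q')
    cong∨ : ∀ {p p' q q'} → V ⊢ p ≈ p' → V ⊢ q ≈ q' → V ⊢ (p ∨• q) ≈ (p' ∨• q')

  infix 4 EqMFELU⊢_≈_
  EqMFELU⊢_≈_ : SP → SP → Set
  EqMFELU⊢ p ≈ q = ⊥ ⊢ p ≈ q

  data Tree : Set where
    T F U : Tree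
    _◁_▷_ : Tree → Atom → Tree → Tree

  _[T↦_,F↦_] : Tree → Tree → Tree → Tree
  T [T↦ Y ,F↦ Z ] = Y
  F [T↦ Y ,F↦ Z ] = Z
  U [T↦ Y ,F↦ Z ] = U
  (X₁ ◁ a ▷ X₂) [T↦ Y ,F↦ Z ] = (X₁ [T↦ Y ,F↦ Z ]) ◁ a ▷ (X₂ [T↦ Y ,F↦ Z ])

  fe : SP → Tree
  fe (var ())
  fe `T = T
  fe `F = F
  fe `U = U
  fe (atom a) = T ◁ a ▷ F
  fe (`¬ p) = fe p [T↦ F ,F↦ T ]
  fe (p ∧• q) = fe p [T↦ fe q ,F↦ (fe q [T↦ F ,F↦ F ]) ]
  fe (p ∨• q) = fe p [T↦ (fe q [T↦ T ,F↦ T ]) ,F↦ fe q ]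

  L R : Atom → Tree → Tree
  L a T = T
  L a F = F
  L a U = U
  L a (X ◁ b ▷ Y) with a ≟A b
  ... | yes _ = L a X
  ... | no  _ = L a X ◁ b ▷ L a Y
  R a T = T
  R a F = F
  R a U = U
  R a (X ◁ b ▷ Y) with a ≟A b
  ... | yes _ = R a Y
  ... | no  _ = R a X ◁ b ▷ R a Y

  -- m is not structurally recursive (L_a X is not a syntactic subterm);
  -- we define it with a depth fuel bounded by the tree depth, which
  -- suffices since L_a, R_a do not increase depth.
  depth : Tree → ℕ
  depth T = 0
  depth F = 0
  depth U = 0
  depth (X ◁ _ ▷ Y) = ℕ.suc (depth X ⊔ depth Y)

  m′ : ℕ → Tree → Tree
  m′ _ T = T
  m′ _ F = F
  m′ _ U = U
  m′ ℕ.zero t = t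
  m′ (ℕ.suc n) (X ◁ a ▷ Y) = m′ n (L a X) ◁ a ▷ m′ n (R a Y)

  m : Tree → Tree
  m t = m′ (depth t) t

  mfe : SP → Tree
  mfe p = m (fe p)

-- Soundness: the head of a term (the root of its evaluation tree) is computed
-- compositionally, and provably equal terms have equal heads, also after any sequence
-- of substitutions of terms for atoms.  Since mfe P is determined by the head of P and,
-- when that head is an atom a, by mfe P[a≔T] and mfe P[a≔F], this forces mfe P = mfe Q.
-- Completeness: every term is provably T, F, U, or guarded by its head atom a, that is
-- P = (a ∨ T) ∧ P.  Under the guard a (resp. ¬a) later occurrences of a may be replaced
-- by T (resp. F), which yields the Shannon expansion P = (¬a ∧ P[a≔F]) ∨ (a ∧ P[a≔T]).
-- By induction on the depth of fe P, P is then provably equal to the term read off mfe P.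
module Submission where

open import Defs renaming (_[T↦_,F↦_] to replace-leaves)
open import Data.Fin using (Fin; zero; suc)
open import Data.List using (List; []; _∷_)
open import Data.Nat using (suc; _≤_; _<_; _⊔_; z≤n; s≤s)
open import Data.Nat.Properties using (≤-refl; ≤-trans; <-≤-trans; n≤1+n; m≤m⊔n; m≤n⊔m; ⊔-mono-≤)
open import Data.Product using (_×_; _,_)
open import Relation.Binary.Bundles using (Setoid)
open import Relation.Binary.PropositionalEquality
  using (_≡_; refl; sym; trans; cong; cong₂; ≡-≟-identity)
open import Relation.Nullary using (yes; no)

module _ (𝔸 : Atoms) where
  open Atoms 𝔸

  infix 4 _≈_
  _≈_ : SP 𝔸 → SP 𝔸 → Set
  P ≈ Q = EqMFELU⊢_≈_ 𝔸 P Q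

  _[T↦_,F↦_] : Tree 𝔸 → Tree 𝔸 → Tree 𝔸 → Tree 𝔸
  _[T↦_,F↦_] = replace-leaves 𝔸

  ≈-setoid : Setoid _ _
  ≈-setoid = record
    { Carrier = SP 𝔸
    ; _≈_ = _≈_
    ; isEquivalence = record { refl = refl≈ ; sym = sym≈ ; trans = trans≈ }
    }

  open import Relation.Binary.Reasoning.Setoid ≈-setoid

  assign : SP 𝔸 → SP 𝔸 → SP 𝔸 → Fin 3 → SP 𝔸
  assign p q r zero = p
  assign p q r (suc zero) = q
  assign p q r (suc (suc zero)) = r

  F≈¬T : `F ≈ `¬ `T
  F≈¬T = ax F1 (assign `T `T `T)

  ∨-def : ∀ p q → p ∨• q ≈ `¬ (`¬ p ∧• `¬ q)
  ∨-def p q = ax F2 (assign p q `T)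

  ¬-involutive : ∀ p → `¬ `¬ p ≈ p
  ¬-involutive p = ax F3 (assign p `T `T)

  ∧-assoc : ∀ p q r → (p ∧• q) ∧• r ≈ p ∧• (q ∧• r)
  ∧-assoc p q r = ax F4 (assign p q r)

  ∧-identityˡ : ∀ p → `T ∧• p ≈ p
  ∧-identityˡ p = ax F5 (assign p `T `T)

  ∧-identityʳ : ∀ p → p ∧• `T ≈ p
  ∧-identityʳ p = ax F6 (assign p `T `T)

  x∧F≈F∧x : ∀ p → p ∧• `F ≈ `F ∧• p
  x∧F≈F∧x p = ax F7 (assign p `T `T)

  ¬x∧F≈x∧F : ∀ p → `¬ p ∧• `F ≈ p ∧• `F
  ¬x∧F≈x∧F p = ax F8 (assign p `T `T)

  x∧F∨y≈x∨T∧y : ∀ p q → (p ∧• `F) ∨• q ≈ (p ∨• `T) ∧• q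
  x∧F∨y≈x∨T∧y p q = ax F9 (assign p q `T)

  ∧-distribʳ-∨ : ∀ p q r → (p ∨• q) ∧• r ≈ (`¬ p ∧• (q ∧• r)) ∨• (p ∧• r)
  ∧-distribʳ-∨ p q r = ax M1 (assign p q r)

  ¬U≈U : `¬ `U ≈ `U
  ¬U≈U = ax U1 (assign `T `T `T)

  ∧-zeroˡ : ∀ p → `U ∧• p ≈ `U
  ∧-zeroˡ p = ax U2 (assign p `T `T)

  ¬F≈T : `¬ `F ≈ `T
  ¬F≈T = begin
    `¬ `F    ≈⟨ cong¬ F≈¬T ⟩
    `¬ `¬ `T ≈⟨ ¬-involutive `T ⟩
    `T       ∎

  ∨-identityʳ : ∀ p → p ∨• `F ≈ p
  ∨-identityʳ p = begin
    p ∨• `F               ≈⟨ ∨-def p `F ⟩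
    `¬ (`¬ p ∧• `¬ `F)    ≈⟨ cong¬ (cong∧ refl≈ ¬F≈T) ⟩
    `¬ (`¬ p ∧• `T)       ≈⟨ cong¬ (∧-identityʳ _) ⟩
    `¬ `¬ p               ≈⟨ ¬-involutive p ⟩
    p                     ∎

  deMorgan₁ : ∀ p q → `¬ (p ∧• q) ≈ `¬ p ∨• `¬ q
  deMorgan₁ p q = begin
    `¬ (p ∧• q)               ≈⟨ cong¬ (cong∧ (¬-involutive p) (¬-involutive q)) ⟨
    `¬ (`¬ `¬ p ∧• `¬ `¬ q)   ≈⟨ ∨-def _ _ ⟨
    `¬ p ∨• `¬ q              ∎

  deMorgan₂ : ∀ p q → `¬ (p ∨• q) ≈ `¬ p ∧• `¬ q
  deMorgan₂ p q = begin
    `¬ (p ∨• q)             ≈⟨ cong¬ (∨-def p q) ⟩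
    `¬ `¬ (`¬ p ∧• `¬ q)    ≈⟨ ¬-involutive _ ⟩
    `¬ p ∧• `¬ q            ∎

  ∨-assoc : ∀ p q r → (p ∨• q) ∨• r ≈ p ∨• (q ∨• r)
  ∨-assoc p q r = begin
    (p ∨• q) ∨• r                ≈⟨ ∨-def _ _ ⟩
    `¬ (`¬ (p ∨• q) ∧• `¬ r)     ≈⟨ cong¬ (cong∧ (deMorgan₂ p q) refl≈) ⟩
    `¬ ((`¬ p ∧• `¬ q) ∧• `¬ r)  ≈⟨ cong¬ (∧-assoc _ _ _) ⟩
    `¬ (`¬ p ∧• (`¬ q ∧• `¬ r))  ≈⟨ cong¬ (cong∧ refl≈ (deMorgan₂ q r)) ⟨
    `¬ (`¬ p ∧• `¬ (q ∨• r))     ≈⟨ ∨-def _ _ ⟨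
    p ∨• (q ∨• r)                ∎

  x∨y≈¬x∧y∨x : ∀ p q → p ∨• q ≈ (`¬ p ∧• q) ∨• p
  x∨y≈¬x∧y∨x p q = begin
    p ∨• q                              ≈⟨ ∧-identityʳ _ ⟨
    (p ∨• q) ∧• `T                      ≈⟨ ∧-distribʳ-∨ p q `T ⟩
    (`¬ p ∧• (q ∧• `T)) ∨• (p ∧• `T)    ≈⟨ cong∨ (cong∧ refl≈ (∧-identityʳ q)) (∧-identityʳ p) ⟩
    (`¬ p ∧• q) ∨• p                    ∎

  x∧y≈¬x∨y∧x : ∀ p q → p ∧• q ≈ (`¬ p ∨• q) ∧• p
  x∧y≈¬x∨y∧x p q = begin
    p ∧• q                              ≈⟨ ¬-involutive _ ⟨
    `¬ `¬ (p ∧• q)                      ≈⟨ cong¬ (deMorgan₁ p q) ⟩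
    `¬ (`¬ p ∨• `¬ q)                   ≈⟨ cong¬ (x∨y≈¬x∧y∨x (`¬ p) (`¬ q)) ⟩
    `¬ ((`¬ `¬ p ∧• `¬ q) ∨• `¬ p)      ≈⟨ deMorgan₂ _ _ ⟩
    `¬ (`¬ `¬ p ∧• `¬ q) ∧• `¬ `¬ p     ≈⟨ cong∧ (deMorgan₁ _ _) (¬-involutive p) ⟩
    (`¬ `¬ `¬ p ∨• `¬ `¬ q) ∧• p        ≈⟨ cong∧ (cong∨ (¬-involutive (`¬ p)) (¬-involutive q)) refl≈ ⟩
    (`¬ p ∨• q) ∧• p                    ∎

  x≈x∨T∧x : ∀ p → p ≈ (p ∨• `T) ∧• p
  x≈x∨T∧x p = begin
    p                   ≈⟨ ∨-identityʳ p ⟨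
    p ∨• `F             ≈⟨ x∨y≈¬x∧y∨x p `F ⟩
    (`¬ p ∧• `F) ∨• p   ≈⟨ cong∨ (¬x∧F≈x∧F p) refl≈ ⟩
    (p ∧• `F) ∨• p      ≈⟨ x∧F∨y≈x∨T∧y p p ⟩
    (p ∨• `T) ∧• p      ∎

  x∨T≈¬x∨x : ∀ p → p ∨• `T ≈ `¬ p ∨• p
  x∨T≈¬x∨x p = trans≈ (x∨y≈¬x∧y∨x p `T) (cong∨ (∧-identityʳ _) refl≈)

  ∧-idem : ∀ p → p ∧• p ≈ p
  ∧-idem p = begin
    p ∧• p              ≈⟨ x∧y≈¬x∨y∧x p p ⟩
    (`¬ p ∨• p) ∧• p    ≈⟨ cong∧ (x∨T≈¬x∨x p) refl≈ ⟨
    (p ∨• `T) ∧• p      ≈⟨ x≈x∨T∧x p ⟨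
    p                   ∎

  ∨-idem : ∀ p → p ∨• p ≈ p
  ∨-idem p = begin
    p ∨• p               ≈⟨ ∨-def p p ⟩
    `¬ (`¬ p ∧• `¬ p)    ≈⟨ cong¬ (∧-idem (`¬ p)) ⟩
    `¬ `¬ p              ≈⟨ ¬-involutive p ⟩
    p                    ∎

  ¬x∧x≈¬x∧F : ∀ p → `¬ p ∧• p ≈ `¬ p ∧• `F
  ¬x∧x≈¬x∧F p = begin
    `¬ p ∧• p          ≈⟨ cong∧ refl≈ (¬-involutive p) ⟨
    `¬ p ∧• `¬ `¬ p    ≈⟨ deMorgan₂ p (`¬ p) ⟨
    `¬ (p ∨• `¬ p)     ≈⟨ cong¬ x∨¬x≈x∨T ⟩
    `¬ (p ∨• `T)       ≈⟨ deMorgan₂ p `T ⟩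
    `¬ p ∧• `¬ `T      ≈⟨ cong∧ refl≈ F≈¬T ⟨
    `¬ p ∧• `F         ∎
    where
    x∨¬x≈x∨T : p ∨• `¬ p ≈ p ∨• `T
    x∨¬x≈x∨T = begin
      p ∨• `¬ p             ≈⟨ x∨y≈¬x∧y∨x p (`¬ p) ⟩
      (`¬ p ∧• `¬ p) ∨• p   ≈⟨ cong∨ (∧-idem (`¬ p)) refl≈ ⟩
      `¬ p ∨• p             ≈⟨ x∨T≈¬x∨x p ⟨
      p ∨• `T               ∎

  ¬[x∨T∧y]≈x∨T∧¬y : ∀ p q → `¬ ((p ∨• `T) ∧• q) ≈ (p ∨• `T) ∧• `¬ q
  ¬[x∨T∧y]≈x∨T∧¬y p q = begin
    `¬ ((p ∨• `T) ∧• q)    ≈⟨ cong¬ (x∧F∨y≈x∨T∧y p q) ⟨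
    `¬ ((p ∧• `F) ∨• q)    ≈⟨ deMorgan₂ _ _ ⟩
    `¬ (p ∧• `F) ∧• `¬ q   ≈⟨ cong∧ ¬[x∧F]≈x∨T refl≈ ⟩
    (p ∨• `T) ∧• `¬ q      ∎
    where
    ¬[x∧F]≈x∨T : `¬ (p ∧• `F) ≈ p ∨• `T
    ¬[x∧F]≈x∨T = begin
      `¬ (p ∧• `F)        ≈⟨ cong¬ (¬x∧F≈x∧F p) ⟨
      `¬ (`¬ p ∧• `F)     ≈⟨ cong¬ (cong∧ refl≈ F≈¬T) ⟩
      `¬ (`¬ p ∧• `¬ `T)  ≈⟨ ∨-def _ _ ⟨
      p ∨• `T             ∎

  -- Equality in the context of a previously evaluated guard x.
  infix 4 _≈[_]_
  _≈[_]_ : SP 𝔸 → SP 𝔸 → SP 𝔸 → Set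
  D ≈[ x ] D′ = x ∧• D ≈ x ∧• D′

  ≈[]-¬ : ∀ {x D D′} → D ≈[ x ] D′ → `¬ D ≈[ x ] `¬ D′
  ≈[]-¬ {x} {D} {D′} D≈D′ = begin
    x ∧• `¬ D            ≈⟨ x∧¬y≈x∧¬[x∧y] D ⟩
    x ∧• `¬ (x ∧• D)     ≈⟨ cong∧ refl≈ (cong¬ D≈D′) ⟩
    x ∧• `¬ (x ∧• D′)    ≈⟨ x∧¬y≈x∧¬[x∧y] D′ ⟨
    x ∧• `¬ D′           ∎
    where
    x∧¬y≈x∧¬[x∧y] : ∀ q → x ∧• `¬ q ≈ x ∧• `¬ (x ∧• q)
    x∧¬y≈x∧¬[x∧y] q = begin
      x ∧• `¬ q                      ≈⟨ x∧y≈¬x∨y∧x x (`¬ q) ⟩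
      (`¬ x ∨• `¬ q) ∧• x            ≈⟨ cong∧ (cong∨ (∨-idem (`¬ x)) refl≈) refl≈ ⟨
      ((`¬ x ∨• `¬ x) ∨• `¬ q) ∧• x  ≈⟨ cong∧ (∨-assoc _ _ _) refl≈ ⟩
      (`¬ x ∨• (`¬ x ∨• `¬ q)) ∧• x  ≈⟨ x∧y≈¬x∨y∧x x _ ⟨
      x ∧• (`¬ x ∨• `¬ q)            ≈⟨ cong∧ refl≈ (deMorgan₁ x q) ⟨
      x ∧• `¬ (x ∧• q)               ∎

  ≈[]-∧ : ∀ {x D D′ E E′} → D ≈[ x ] D′ → E ≈[ x ] E′ → D ∧• E ≈[ x ] D′ ∧• E′
  ≈[]-∧ {x} {D} {D′} {E} {E′} D≈D′ E≈E′ = begin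
    x ∧• (D ∧• E)               ≈⟨ ∧-assoc _ _ _ ⟨
    (x ∧• D) ∧• E               ≈⟨ cong∧ D≈D′ refl≈ ⟩
    (x ∧• D′) ∧• E              ≈⟨ ∧-assoc _ _ _ ⟩
    x ∧• (D′ ∧• E)              ≈⟨ x∧[y∧z]≈x∧[y∧[x∧z]] E ⟩
    x ∧• (D′ ∧• (x ∧• E))       ≈⟨ cong∧ refl≈ (cong∧ refl≈ E≈E′) ⟩
    x ∧• (D′ ∧• (x ∧• E′))      ≈⟨ x∧[y∧z]≈x∧[y∧[x∧z]] E′ ⟨
    x ∧• (D′ ∧• E′)             ∎
    where
    x∧y∧x≈x∧y : (x ∧• D′) ∧• x ≈ x ∧• D′
    x∧y∧x≈x∧y = begin
      (x ∧• D′) ∧• x              ≈⟨ cong∧ (x∧y≈¬x∨y∧x x D′) refl≈ ⟩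
      ((`¬ x ∨• D′) ∧• x) ∧• x    ≈⟨ ∧-assoc _ _ _ ⟩
      (`¬ x ∨• D′) ∧• (x ∧• x)    ≈⟨ cong∧ refl≈ (∧-idem x) ⟩
      (`¬ x ∨• D′) ∧• x           ≈⟨ x∧y≈¬x∨y∧x x D′ ⟨
      x ∧• D′                     ∎
    x∧[y∧z]≈x∧[y∧[x∧z]] : ∀ r → x ∧• (D′ ∧• r) ≈ x ∧• (D′ ∧• (x ∧• r))
    x∧[y∧z]≈x∧[y∧[x∧z]] r = begin
      x ∧• (D′ ∧• r)              ≈⟨ ∧-assoc _ _ _ ⟨
      (x ∧• D′) ∧• r              ≈⟨ cong∧ x∧y∧x≈x∧y refl≈ ⟨
      ((x ∧• D′) ∧• x) ∧• r       ≈⟨ ∧-assoc _ _ _ ⟩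
      (x ∧• D′) ∧• (x ∧• r)       ≈⟨ ∧-assoc _ _ _ ⟩
      x ∧• (D′ ∧• (x ∧• r))       ∎

  ≈[]-∨ : ∀ {x D D′ E E′} → D ≈[ x ] D′ → E ≈[ x ] E′ → D ∨• E ≈[ x ] D′ ∨• E′
  ≈[]-∨ {x} {D} {D′} {E} {E′} D≈D′ E≈E′ = begin
    x ∧• (D ∨• E)                 ≈⟨ cong∧ refl≈ (∨-def D E) ⟩
    x ∧• `¬ (`¬ D ∧• `¬ E)        ≈⟨ ≈[]-¬ (≈[]-∧ (≈[]-¬ D≈D′) (≈[]-¬ E≈E′)) ⟩
    x ∧• `¬ (`¬ D′ ∧• `¬ E′)      ≈⟨ cong∧ refl≈ (∨-def D′ E′) ⟨
    x ∧• (D′ ∨• E′)               ∎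

  infix 10 _[_≔_]
  _[_≔_] : SP 𝔸 → Atom → SP 𝔸 → SP 𝔸
  var () [ a ≔ c ]
  `T [ a ≔ c ] = `T
  `F [ a ≔ c ] = `F
  `U [ a ≔ c ] = `U
  atom b [ a ≔ c ] with a ≟A b
  ... | yes _ = c
  ... | no _  = atom b
  (`¬ P) [ a ≔ c ] = `¬ P [ a ≔ c ]
  (P ∧• Q) [ a ≔ c ] = P [ a ≔ c ] ∧• Q [ a ≔ c ]
  (P ∨• Q) [ a ≔ c ] = P [ a ≔ c ] ∨• Q [ a ≔ c ]

  ≈[]-≔ : ∀ {x a c} → atom a ≈[ x ] c → ∀ C → C ≈[ x ] C [ a ≔ c ]
  ≈[]-≔ a≈c (var ())
  ≈[]-≔ a≈c `T = refl≈
  ≈[]-≔ a≈c `F = refl≈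
  ≈[]-≔ a≈c `U = refl≈
  ≈[]-≔ {a = a} a≈c (atom b) with a ≟A b
  ... | yes refl = a≈c
  ... | no _     = refl≈
  ≈[]-≔ a≈c (`¬ C) = ≈[]-¬ (≈[]-≔ a≈c C)
  ≈[]-≔ a≈c (C ∧• D) = ≈[]-∧ (≈[]-≔ a≈c C) (≈[]-≔ a≈c D)
  ≈[]-≔ a≈c (C ∨• D) = ≈[]-∨ (≈[]-≔ a≈c C) (≈[]-≔ a≈c D)

  shannon : ∀ {a P} → P ≈ (atom a ∨• `T) ∧• P →
            P ≈ (`¬ atom a ∧• P [ a ≔ `F ]) ∨• (atom a ∧• P [ a ≔ `T ])
  shannon {a} {P} P≈a∨T∧P = begin
    P                                                  ≈⟨ P≈a∨T∧P ⟩
    (atom a ∨• `T) ∧• P                                ≈⟨ ∧-distribʳ-∨ _ _ _ ⟩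
    (`¬ atom a ∧• (`T ∧• P)) ∨• (atom a ∧• P)          ≈⟨ cong∨ (cong∧ refl≈ (∧-identityˡ P)) refl≈ ⟩
    (`¬ atom a ∧• P) ∨• (atom a ∧• P)                  ≈⟨ cong∨ (≈[]-≔ (¬x∧x≈¬x∧F (atom a)) P) (≈[]-≔ a∧a≈a∧T P) ⟩
    (`¬ atom a ∧• P [ a ≔ `F ]) ∨• (atom a ∧• P [ a ≔ `T ]) ∎
    where
    a∧a≈a∧T : atom a ≈[ atom a ] `T
    a∧a≈a∧T = trans≈ (∧-idem _) (sym≈ (∧-identityʳ _))

  -- The root of fe P, computed from P: the connectives on heads copy the clauses of fe.
  data Head : Set where
    Tʰ Fʰ Uʰ : Head
    atomʰ : Atom → Head

  _[T↦_,F↦_]ʰ : Head → Head → Head → Head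
  Tʰ [T↦ k ,F↦ j ]ʰ = k
  Fʰ [T↦ k ,F↦ j ]ʰ = j
  Uʰ [T↦ k ,F↦ j ]ʰ = Uʰ
  atomʰ a [T↦ k ,F↦ j ]ʰ = atomʰ a

  infix 8 ¬ʰ_
  infixr 7 _∧ʰ_
  infixr 6 _∨ʰ_

  ¬ʰ_ : Head → Head
  ¬ʰ h = h [T↦ Fʰ ,F↦ Tʰ ]ʰ

  _∧ʰ_ : Head → Head → Head
  h ∧ʰ k = h [T↦ k ,F↦ k [T↦ Fʰ ,F↦ Fʰ ]ʰ ]ʰ

  _∨ʰ_ : Head → Head → Head
  h ∨ʰ k = h [T↦ k [T↦ Tʰ ,F↦ Tʰ ]ʰ ,F↦ k ]ʰ

  hd : SP 𝔸 → Head
  hd (var ())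
  hd `T = Tʰ
  hd `F = Fʰ
  hd `U = Uʰ
  hd (atom a) = atomʰ a
  hd (`¬ P) = ¬ʰ hd P
  hd (P ∧• Q) = hd P ∧ʰ hd Q
  hd (P ∨• Q) = hd P ∨ʰ hd Q

  ∨ʰ-def : ∀ h k → ¬ʰ (¬ʰ h ∧ʰ ¬ʰ k) ≡ h ∨ʰ k
  ∨ʰ-def Tʰ Tʰ = refl
  ∨ʰ-def Tʰ Fʰ = refl
  ∨ʰ-def Tʰ Uʰ = refl
  ∨ʰ-def Tʰ (atomʰ _) = refl
  ∨ʰ-def Fʰ Tʰ = refl
  ∨ʰ-def Fʰ Fʰ = refl
  ∨ʰ-def Fʰ Uʰ = refl
  ∨ʰ-def Fʰ (atomʰ _) = refl
  ∨ʰ-def Uʰ k = refl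
  ∨ʰ-def (atomʰ _) k = refl

  -- (a ∨• T) ∧• P evaluates a, ignores its value and continues as P.
  Headed : Head → SP 𝔸 → Set
  Headed Tʰ P = P ≈ `T
  Headed Fʰ P = P ≈ `F
  Headed Uʰ P = P ≈ `U
  Headed (atomʰ a) P = P ≈ (atom a ∨• `T) ∧• P

  headed-resp : ∀ h {P P′} → P ≈ P′ → Headed h P′ → Headed h P
  headed-resp Tʰ P≈P′ H = trans≈ P≈P′ H
  headed-resp Fʰ P≈P′ H = trans≈ P≈P′ H
  headed-resp Uʰ P≈P′ H = trans≈ P≈P′ H
  headed-resp (atomʰ a) P≈P′ H = trans≈ P≈P′ (trans≈ H (cong∧ refl≈ (sym≈ P≈P′)))

  headed-¬ : ∀ h {P} → Headed h P → Headed (¬ʰ h) (`¬ P)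
  headed-¬ Tʰ H = trans≈ (cong¬ H) (sym≈ F≈¬T)
  headed-¬ Fʰ H = trans≈ (cong¬ H) ¬F≈T
  headed-¬ Uʰ H = trans≈ (cong¬ H) ¬U≈U
  headed-¬ (atomʰ a) H = trans≈ (cong¬ H) (¬[x∨T∧y]≈x∨T∧¬y _ _)

  headed-∧ : ∀ h k {P Q} → Headed h P → Headed k Q → Headed (h ∧ʰ k) (P ∧• Q)
  headed-∧ Tʰ k HP HQ = headed-resp k (trans≈ (cong∧ HP refl≈) (∧-identityˡ _)) HQ
  headed-∧ Fʰ Tʰ HP HQ = trans≈ (cong∧ HP HQ) (∧-identityʳ `F)
  headed-∧ Fʰ Fʰ HP HQ = trans≈ (cong∧ HP HQ) (∧-idem `F)
  headed-∧ Fʰ Uʰ HP HQ = trans≈ (cong∧ HP HQ) (trans≈ (sym≈ (x∧F≈F∧x `U)) (∧-zeroˡ `F))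
  headed-∧ Fʰ (atomʰ a) {P} {Q} HP HQ = begin
    P ∧• Q                                 ≈⟨ cong∧ HP refl≈ ⟩
    `F ∧• Q                                ≈⟨ x∧F≈F∧x Q ⟨
    Q ∧• `F                                ≈⟨ cong∧ HQ refl≈ ⟩
    ((atom a ∨• `T) ∧• Q) ∧• `F            ≈⟨ ∧-assoc _ _ _ ⟩
    (atom a ∨• `T) ∧• (Q ∧• `F)            ≈⟨ cong∧ refl≈ (x∧F≈F∧x Q) ⟩
    (atom a ∨• `T) ∧• (`F ∧• Q)            ≈⟨ cong∧ refl≈ (cong∧ HP refl≈) ⟨
    (atom a ∨• `T) ∧• (P ∧• Q)             ∎
  headed-∧ Uʰ k HP HQ = trans≈ (cong∧ HP refl≈) (∧-zeroˡ _)
  headed-∧ (atomʰ a) k HP HQ = trans≈ (cong∧ HP refl≈) (∧-assoc _ _ _)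

  headed-∨ : ∀ h k {P Q} → Headed h P → Headed k Q → Headed (h ∨ʰ k) (P ∨• Q)
  headed-∨ h k {P} {Q} HP HQ rewrite sym (∨ʰ-def h k) =
    headed-resp (¬ʰ (¬ʰ h ∧ʰ ¬ʰ k)) (∨-def P Q)
      (headed-¬ _ (headed-∧ _ _ (headed-¬ h HP) (headed-¬ k HQ)))

  headed : ∀ P → Headed (hd P) P
  headed (var ())
  headed `T = refl≈
  headed `F = refl≈
  headed `U = refl≈
  headed (atom a) = x≈x∨T∧x (atom a)
  headed (`¬ P) = headed-¬ (hd P) (headed P)
  headed (P ∧• Q) = headed-∧ (hd P) (hd Q) (headed P) (headed Q)
  headed (P ∨• Q) = headed-∨ (hd P) (hd Q) (headed P) (headed Q)

  head : Tree 𝔸 → Head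
  head T = Tʰ
  head F = Fʰ
  head U = Uʰ
  head (_ ◁ a ▷ _) = atomʰ a

  head-replace : ∀ X Y Z → head (X [T↦ Y ,F↦ Z ]) ≡ head X [T↦ head Y ,F↦ head Z ]ʰ
  head-replace T Y Z = refl
  head-replace F Y Z = refl
  head-replace U Y Z = refl
  head-replace (_ ◁ _ ▷ _) Y Z = refl

  head-fe : ∀ P → head (fe 𝔸 P) ≡ hd P
  head-fe (var ())
  head-fe `T = refl
  head-fe `F = refl
  head-fe `U = refl
  head-fe (atom a) = refl
  head-fe (`¬ P)
    rewrite head-replace (fe 𝔸 P) F T | head-fe P = refl
  head-fe (P ∧• Q)
    rewrite head-replace (fe 𝔸 P) (fe 𝔸 Q) (fe 𝔸 Q [T↦ F ,F↦ F ])
          | head-replace (fe 𝔸 Q) F F | head-fe P | head-fe Q = refl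
  head-fe (P ∨• Q)
    rewrite head-replace (fe 𝔸 P) (fe 𝔸 Q [T↦ T ,F↦ T ]) (fe 𝔸 Q)
          | head-replace (fe 𝔸 Q) T T | head-fe P | head-fe Q = refl

  L-replace : ∀ a X Y Z → L 𝔸 a (X [T↦ Y ,F↦ Z ]) ≡ L 𝔸 a X [T↦ L 𝔸 a Y ,F↦ L 𝔸 a Z ]
  L-replace a T Y Z = refl
  L-replace a F Y Z = refl
  L-replace a U Y Z = refl
  L-replace a (X ◁ b ▷ X′) Y Z with a ≟A b
  ... | yes _ = L-replace a X Y Z
  ... | no _  = cong₂ (_◁ b ▷_) (L-replace a X Y Z) (L-replace a X′ Y Z)

  R-replace : ∀ a X Y Z → R 𝔸 a (X [T↦ Y ,F↦ Z ]) ≡ R 𝔸 a X [T↦ R 𝔸 a Y ,F↦ R 𝔸 a Z ]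
  R-replace a T Y Z = refl
  R-replace a F Y Z = refl
  R-replace a U Y Z = refl
  R-replace a (X ◁ b ▷ X′) Y Z with a ≟A b
  ... | yes _ = R-replace a X′ Y Z
  ... | no _  = cong₂ (_◁ b ▷_) (R-replace a X Y Z) (R-replace a X′ Y Z)

  -- fe turns every connective into a leaf replacement, so it suffices that S commutes
  -- with leaf replacement and agrees with the substitution on atoms.
  fe-≔ : ∀ a c (S : Tree 𝔸 → Tree 𝔸) →
         (∀ X Y Z → S (X [T↦ Y ,F↦ Z ]) ≡ S X [T↦ S Y ,F↦ S Z ]) →
         S T ≡ T → S F ≡ F → S U ≡ U → (∀ b → fe 𝔸 (atom b [ a ≔ c ]) ≡ S (fe 𝔸 (atom b))) →
         ∀ P → fe 𝔸 (P [ a ≔ c ]) ≡ S (fe 𝔸 P)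
  fe-≔ a c S S-replace ST SF SU S-atom = go
    where
    go : ∀ P → fe 𝔸 (P [ a ≔ c ]) ≡ S (fe 𝔸 P)
    go (var ())
    go `T = sym ST
    go `F = sym SF
    go `U = sym SU
    go (atom b) = S-atom b
    go (`¬ P) rewrite S-replace (fe 𝔸 P) F T | ST | SF | go P = refl
    go (P ∧• Q)
      rewrite S-replace (fe 𝔸 P) (fe 𝔸 Q) (fe 𝔸 Q [T↦ F ,F↦ F ])
            | S-replace (fe 𝔸 Q) F F | SF | go P | go Q = refl
    go (P ∨• Q)
      rewrite S-replace (fe 𝔸 P) (fe 𝔸 Q [T↦ T ,F↦ T ]) (fe 𝔸 Q)
            | S-replace (fe 𝔸 Q) T T | ST | go P | go Q = refl

  fe-≔T : ∀ a P → fe 𝔸 (P [ a ≔ `T ]) ≡ L 𝔸 a (fe 𝔸 P)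
  fe-≔T a = fe-≔ a `T (L 𝔸 a) (L-replace a) refl refl refl atom-case
    where
    atom-case : ∀ b → fe 𝔸 (atom b [ a ≔ `T ]) ≡ L 𝔸 a (fe 𝔸 (atom b))
    atom-case b with a ≟A b
    ... | yes _ = refl
    ... | no _  = refl

  fe-≔F : ∀ a P → fe 𝔸 (P [ a ≔ `F ]) ≡ R 𝔸 a (fe 𝔸 P)
  fe-≔F a = fe-≔ a `F (R 𝔸 a) (R-replace a) refl refl refl atom-case
    where
    atom-case : ∀ b → fe 𝔸 (atom b [ a ≔ `F ]) ≡ R 𝔸 a (fe 𝔸 (atom b))
    atom-case b with a ≟A b
    ... | yes _ = refl
    ... | no _  = refl

  L-self : ∀ a X Y → L 𝔸 a (X ◁ a ▷ Y) ≡ L 𝔸 a X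
  L-self a X Y rewrite ≡-≟-identity _≟A_ (refl {x = a}) = refl

  R-self : ∀ a X Y → R 𝔸 a (X ◁ a ▷ Y) ≡ R 𝔸 a Y
  R-self a X Y rewrite ≡-≟-identity _≟A_ (refl {x = a}) = refl

  depth-L : ∀ a t → depth 𝔸 (L 𝔸 a t) ≤ depth 𝔸 t
  depth-L a T = z≤n
  depth-L a F = z≤n
  depth-L a U = z≤n
  depth-L a (X ◁ b ▷ Y) with a ≟A b
  ... | yes _ = ≤-trans (depth-L a X) (≤-trans (m≤m⊔n _ _) (n≤1+n _))
  ... | no _  = s≤s (⊔-mono-≤ (depth-L a X) (depth-L a Y))

  depth-R : ∀ a t → depth 𝔸 (R 𝔸 a t) ≤ depth 𝔸 t
  depth-R a T = z≤n
  depth-R a F = z≤n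
  depth-R a U = z≤n
  depth-R a (X ◁ b ▷ Y) with a ≟A b
  ... | yes _ = ≤-trans (depth-R a Y) (≤-trans (m≤n⊔m _ _) (n≤1+n _))
  ... | no _  = s≤s (⊔-mono-≤ (depth-R a X) (depth-R a Y))

  depth-L< : ∀ {a} t → head t ≡ atomʰ a → depth 𝔸 (L 𝔸 a t) < depth 𝔸 t
  depth-L< (X ◁ a ▷ Y) refl rewrite L-self a X Y = s≤s (≤-trans (depth-L a X) (m≤m⊔n _ _))

  depth-R< : ∀ {a} t → head t ≡ atomʰ a → depth 𝔸 (R 𝔸 a t) < depth 𝔸 t
  depth-R< (X ◁ a ▷ Y) refl rewrite R-self a X Y = s≤s (≤-trans (depth-R a Y) (m≤n⊔m _ _))

  m′-fuel : ∀ {n k} t → depth 𝔸 t ≤ n → depth 𝔸 t ≤ k → m′ 𝔸 n t ≡ m′ 𝔸 k t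
  m′-fuel T _ _ = refl
  m′-fuel F _ _ = refl
  m′-fuel U _ _ = refl
  m′-fuel {suc n} {suc k} (X ◁ a ▷ Y) (s≤s d≤n) (s≤s d≤k) =
    cong₂ (_◁ a ▷_) (m′-fuel (L 𝔸 a X) (L≤ d≤n) (L≤ d≤k)) (m′-fuel (R 𝔸 a Y) (R≤ d≤n) (R≤ d≤k))
    where
    L≤ : ∀ {j} → depth 𝔸 X ⊔ depth 𝔸 Y ≤ j → depth 𝔸 (L 𝔸 a X) ≤ j
    L≤ d = ≤-trans (depth-L a X) (≤-trans (m≤m⊔n _ _) d)
    R≤ : ∀ {j} → depth 𝔸 X ⊔ depth 𝔸 Y ≤ j → depth 𝔸 (R 𝔸 a Y) ≤ j
    R≤ d = ≤-trans (depth-R a Y) (≤-trans (m≤n⊔m _ _) d)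

  m-node : ∀ X a Y → m 𝔸 (X ◁ a ▷ Y) ≡ m 𝔸 (L 𝔸 a X) ◁ a ▷ m 𝔸 (R 𝔸 a Y)
  m-node X a Y = cong₂ (_◁ a ▷_)
    (m′-fuel (L 𝔸 a X) (≤-trans (depth-L a X) (m≤m⊔n _ _)) ≤-refl)
    (m′-fuel (R 𝔸 a Y) (≤-trans (depth-R a Y) (m≤n⊔m _ _)) ≤-refl)

  unfold : Head → Tree 𝔸 → Tree 𝔸
  unfold Tʰ t = T
  unfold Fʰ t = F
  unfold Uʰ t = U
  unfold (atomʰ a) t = m 𝔸 (L 𝔸 a t) ◁ a ▷ m 𝔸 (R 𝔸 a t)

  m-unfold : ∀ t → m 𝔸 t ≡ unfold (head t) t
  m-unfold T = refl
  m-unfold F = refl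
  m-unfold U = refl
  m-unfold (X ◁ a ▷ Y) rewrite L-self a X Y | R-self a X Y = m-node X a Y

  expand : Head → SP 𝔸 → Tree 𝔸
  expand Tʰ P = T
  expand Fʰ P = F
  expand Uʰ P = U
  expand (atomʰ a) P = mfe 𝔸 (P [ a ≔ `T ]) ◁ a ▷ mfe 𝔸 (P [ a ≔ `F ])

  mfe-expand : ∀ P → mfe 𝔸 P ≡ expand (hd P) P
  mfe-expand P rewrite m-unfold (fe 𝔸 P) | head-fe P = unfold-fe (hd P)
    where
    unfold-fe : ∀ h → unfold h (fe 𝔸 P) ≡ expand h P
    unfold-fe Tʰ = refl
    unfold-fe Fʰ = refl
    unfold-fe Uʰ = refl
    unfold-fe (atomʰ a) = cong₂ (λ X Y → m 𝔸 X ◁ a ▷ m 𝔸 Y) (sym (fe-≔T a P)) (sym (fe-≔F a P))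

  depth-≔T< : ∀ {a} P → hd P ≡ atomʰ a → depth 𝔸 (fe 𝔸 (P [ a ≔ `T ])) < depth 𝔸 (fe 𝔸 P)
  depth-≔T< {a} P hd≡a rewrite fe-≔T a P = depth-L< (fe 𝔸 P) (trans (head-fe P) hd≡a)

  depth-≔F< : ∀ {a} P → hd P ≡ atomʰ a → depth 𝔸 (fe 𝔸 (P [ a ≔ `F ])) < depth 𝔸 (fe 𝔸 P)
  depth-≔F< {a} P hd≡a rewrite fe-≔F a P = depth-R< (fe 𝔸 P) (trans (head-fe P) hd≡a)

  ⌜_⌝ : Tree 𝔸 → SP 𝔸
  ⌜ T ⌝ = `T
  ⌜ F ⌝ = `F
  ⌜ U ⌝ = `U
  ⌜ X ◁ a ▷ Y ⌝ = (`¬ atom a ∧• ⌜ Y ⌝) ∨• (atom a ∧• ⌜ X ⌝)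

  ≈⌜mfe⌝ : ∀ n P → depth 𝔸 (fe 𝔸 P) < n → P ≈ ⌜ mfe 𝔸 P ⌝
  ≈⌜mfe⌝ (suc n) P (s≤s d) = begin
    P                    ≈⟨ by-head (hd P) refl (headed P) ⟩
    ⌜ expand (hd P) P ⌝  ≡⟨ cong ⌜_⌝ (mfe-expand P) ⟨
    ⌜ mfe 𝔸 P ⌝          ∎
    where
    by-head : ∀ h → hd P ≡ h → Headed h P → P ≈ ⌜ expand h P ⌝
    by-head Tʰ _ H = H
    by-head Fʰ _ H = H
    by-head Uʰ _ H = H
    by-head (atomʰ a) hd≡a H = trans≈ (shannon H)
      (cong∨ (cong∧ refl≈ (≈⌜mfe⌝ n _ (<-≤-trans (depth-≔F< P hd≡a) d)))
             (cong∧ refl≈ (≈⌜mfe⌝ n _ (<-≤-trans (depth-≔T< P hd≡a) d))))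

  ¬ʰ-involutive : ∀ h → ¬ʰ ¬ʰ h ≡ h
  ¬ʰ-involutive Tʰ = refl
  ¬ʰ-involutive Fʰ = refl
  ¬ʰ-involutive Uʰ = refl
  ¬ʰ-involutive (atomʰ _) = refl

  ∧ʰ-assoc : ∀ h k j → (h ∧ʰ k) ∧ʰ j ≡ h ∧ʰ (k ∧ʰ j)
  ∧ʰ-assoc Tʰ k j = refl
  ∧ʰ-assoc Fʰ Tʰ j = refl
  ∧ʰ-assoc Fʰ Fʰ Tʰ = refl
  ∧ʰ-assoc Fʰ Fʰ Fʰ = refl
  ∧ʰ-assoc Fʰ Fʰ Uʰ = refl
  ∧ʰ-assoc Fʰ Fʰ (atomʰ _) = refl
  ∧ʰ-assoc Fʰ Uʰ j = refl
  ∧ʰ-assoc Fʰ (atomʰ _) j = refl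
  ∧ʰ-assoc Uʰ k j = refl
  ∧ʰ-assoc (atomʰ _) k j = refl

  ∧ʰ-identityʳ : ∀ h → h ∧ʰ Tʰ ≡ h
  ∧ʰ-identityʳ Tʰ = refl
  ∧ʰ-identityʳ Fʰ = refl
  ∧ʰ-identityʳ Uʰ = refl
  ∧ʰ-identityʳ (atomʰ _) = refl

  h∧F≡F∧h : ∀ h → h ∧ʰ Fʰ ≡ Fʰ ∧ʰ h
  h∧F≡F∧h Tʰ = refl
  h∧F≡F∧h Fʰ = refl
  h∧F≡F∧h Uʰ = refl
  h∧F≡F∧h (atomʰ _) = refl

  ¬h∧F≡h∧F : ∀ h → ¬ʰ h ∧ʰ Fʰ ≡ h ∧ʰ Fʰ
  ¬h∧F≡h∧F Tʰ = refl
  ¬h∧F≡h∧F Fʰ = refl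
  ¬h∧F≡h∧F Uʰ = refl
  ¬h∧F≡h∧F (atomʰ _) = refl

  h∧F∨k≡h∨T∧k : ∀ h k → (h ∧ʰ Fʰ) ∨ʰ k ≡ (h ∨ʰ Tʰ) ∧ʰ k
  h∧F∨k≡h∨T∧k Tʰ k = refl
  h∧F∨k≡h∨T∧k Fʰ k = refl
  h∧F∨k≡h∨T∧k Uʰ k = refl
  h∧F∨k≡h∨T∧k (atomʰ _) k = refl

  h∨k∧F≡h∧k∨T : ∀ h k → h ∨ʰ (k ∧ʰ Fʰ) ≡ h ∧ʰ (k ∨ʰ Tʰ)
  h∨k∧F≡h∧k∨T Tʰ Tʰ = refl
  h∨k∧F≡h∧k∨T Tʰ Fʰ = refl
  h∨k∧F≡h∧k∨T Tʰ Uʰ = refl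
  h∨k∧F≡h∧k∨T Tʰ (atomʰ _) = refl
  h∨k∧F≡h∧k∨T Fʰ Tʰ = refl
  h∨k∧F≡h∧k∨T Fʰ Fʰ = refl
  h∨k∧F≡h∧k∨T Fʰ Uʰ = refl
  h∨k∧F≡h∧k∨T Fʰ (atomʰ _) = refl
  h∨k∧F≡h∧k∨T Uʰ k = refl
  h∨k∧F≡h∧k∨T (atomʰ _) k = refl

  ∧ʰ-distribʳ-∨ʰ : ∀ h k j → (h ∨ʰ k) ∧ʰ j ≡ (¬ʰ h ∧ʰ (k ∧ʰ j)) ∨ʰ (h ∧ʰ j)
  ∧ʰ-distribʳ-∨ʰ Tʰ Tʰ Tʰ = refl
  ∧ʰ-distribʳ-∨ʰ Tʰ Tʰ Fʰ = refl
  ∧ʰ-distribʳ-∨ʰ Tʰ Tʰ Uʰ = refl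
  ∧ʰ-distribʳ-∨ʰ Tʰ Tʰ (atomʰ _) = refl
  ∧ʰ-distribʳ-∨ʰ Tʰ Fʰ Tʰ = refl
  ∧ʰ-distribʳ-∨ʰ Tʰ Fʰ Fʰ = refl
  ∧ʰ-distribʳ-∨ʰ Tʰ Fʰ Uʰ = refl
  ∧ʰ-distribʳ-∨ʰ Tʰ Fʰ (atomʰ _) = refl
  ∧ʰ-distribʳ-∨ʰ Tʰ Uʰ j = refl
  ∧ʰ-distribʳ-∨ʰ Tʰ (atomʰ _) j = refl
  ∧ʰ-distribʳ-∨ʰ Fʰ Tʰ Tʰ = refl
  ∧ʰ-distribʳ-∨ʰ Fʰ Tʰ Fʰ = refl
  ∧ʰ-distribʳ-∨ʰ Fʰ Tʰ Uʰ = refl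
  ∧ʰ-distribʳ-∨ʰ Fʰ Tʰ (atomʰ _) = refl
  ∧ʰ-distribʳ-∨ʰ Fʰ Fʰ Tʰ = refl
  ∧ʰ-distribʳ-∨ʰ Fʰ Fʰ Fʰ = refl
  ∧ʰ-distribʳ-∨ʰ Fʰ Fʰ Uʰ = refl
  ∧ʰ-distribʳ-∨ʰ Fʰ Fʰ (atomʰ _) = refl
  ∧ʰ-distribʳ-∨ʰ Fʰ Uʰ j = refl
  ∧ʰ-distribʳ-∨ʰ Fʰ (atomʰ _) j = refl
  ∧ʰ-distribʳ-∨ʰ Uʰ k j = refl
  ∧ʰ-distribʳ-∨ʰ (atomʰ _) k j = refl

  infix 10 _⟦_⟧
  _⟦_⟧ : SP 𝔸 → List (Atom × SP 𝔸) → SP 𝔸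
  P ⟦ [] ⟧ = P
  P ⟦ (a , c) ∷ ρ ⟧ = (P [ a ≔ c ]) ⟦ ρ ⟧

  ⟦⟧-¬ : ∀ ρ {P} → (`¬ P) ⟦ ρ ⟧ ≡ `¬ (P ⟦ ρ ⟧)
  ⟦⟧-¬ [] = refl
  ⟦⟧-¬ (_ ∷ ρ) = ⟦⟧-¬ ρ

  ⟦⟧-∧ : ∀ ρ {P Q} → (P ∧• Q) ⟦ ρ ⟧ ≡ P ⟦ ρ ⟧ ∧• Q ⟦ ρ ⟧
  ⟦⟧-∧ [] = refl
  ⟦⟧-∧ (_ ∷ ρ) = ⟦⟧-∧ ρ

  ⟦⟧-∨ : ∀ ρ {P Q} → (P ∨• Q) ⟦ ρ ⟧ ≡ P ⟦ ρ ⟧ ∨• Q ⟦ ρ ⟧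
  ⟦⟧-∨ [] = refl
  ⟦⟧-∨ (_ ∷ ρ) = ⟦⟧-∨ ρ

  -- The axioms contain no atoms, so substituting atoms commutes with instantiating them.
  ≔-instance : ∀ {l r} → Axiom 𝔸 l r → ∀ a c σ →
    subst 𝔸 σ l [ a ≔ c ] ≡ subst 𝔸 (λ i → σ i [ a ≔ c ]) l ×
    subst 𝔸 σ r [ a ≔ c ] ≡ subst 𝔸 (λ i → σ i [ a ≔ c ]) r
  ≔-instance F1 a c σ = refl , refl
  ≔-instance F2 a c σ = refl , refl
  ≔-instance F3 a c σ = refl , refl
  ≔-instance F4 a c σ = refl , refl
  ≔-instance F5 a c σ = refl , refl
  ≔-instance F6 a c σ = refl , refl
  ≔-instance F7 a c σ = refl , refl
  ≔-instance F8 a c σ = refl , refl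
  ≔-instance F9 a c σ = refl , refl
  ≔-instance F10 a c σ = refl , refl
  ≔-instance M1 a c σ = refl , refl
  ≔-instance U1 a c σ = refl , refl
  ≔-instance U2 a c σ = refl , refl

  hd-instance : ∀ {l r} → Axiom 𝔸 l r → ∀ σ → hd (subst 𝔸 σ l) ≡ hd (subst 𝔸 σ r)
  hd-instance F1 σ = refl
  hd-instance F2 σ = sym (∨ʰ-def (hd (σ zero)) (hd (σ (suc zero))))
  hd-instance F3 σ = ¬ʰ-involutive (hd (σ zero))
  hd-instance F4 σ = ∧ʰ-assoc (hd (σ zero)) (hd (σ (suc zero))) (hd (σ (suc (suc zero))))
  hd-instance F5 σ = refl
  hd-instance F6 σ = ∧ʰ-identityʳ (hd (σ zero))
  hd-instance F7 σ = h∧F≡F∧h (hd (σ zero))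
  hd-instance F8 σ = ¬h∧F≡h∧F (hd (σ zero))
  hd-instance F9 σ = h∧F∨k≡h∨T∧k (hd (σ zero)) (hd (σ (suc zero)))
  hd-instance F10 σ = h∨k∧F≡h∧k∨T (hd (σ zero)) (hd (σ (suc zero)))
  hd-instance M1 σ = ∧ʰ-distribʳ-∨ʰ (hd (σ zero)) (hd (σ (suc zero))) (hd (σ (suc (suc zero))))
  hd-instance U1 σ = refl
  hd-instance U2 σ = refl

  -- These heads are exactly the observations that mfe retains.
  infix 4 _≋_
  _≋_ : SP 𝔸 → SP 𝔸 → Set
  P ≋ Q = ∀ ρ → hd (P ⟦ ρ ⟧) ≡ hd (Q ⟦ ρ ⟧)

  ≋-instance : ∀ {l r} → Axiom 𝔸 l r → ∀ σ → subst 𝔸 σ l ≋ subst 𝔸 σ r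
  ≋-instance A σ [] = hd-instance A σ
  ≋-instance A σ ((a , c) ∷ ρ) with ≔-instance A a c σ
  ... | l≡ , r≡ rewrite l≡ | r≡ = ≋-instance A (λ i → σ i [ a ≔ c ]) ρ

  ≈⇒≋ : ∀ {P Q} → P ≈ Q → P ≋ Q
  ≈⇒≋ (ax A σ) = ≋-instance A σ
  ≈⇒≋ refl≈ ρ = refl
  ≈⇒≋ (sym≈ P≈Q) ρ = sym (≈⇒≋ P≈Q ρ)
  ≈⇒≋ (trans≈ P≈Q Q≈R) ρ = trans (≈⇒≋ P≈Q ρ) (≈⇒≋ Q≈R ρ)
  ≈⇒≋ (cong¬ {P} {P′} P≈P′) ρ
    rewrite ⟦⟧-¬ ρ {P} | ⟦⟧-¬ ρ {P′} = cong ¬ʰ_ (≈⇒≋ P≈P′ ρ)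
  ≈⇒≋ (cong∧ {P} {P′} {Q} {Q′} P≈P′ Q≈Q′) ρ
    rewrite ⟦⟧-∧ ρ {P} {Q} | ⟦⟧-∧ ρ {P′} {Q′} = cong₂ _∧ʰ_ (≈⇒≋ P≈P′ ρ) (≈⇒≋ Q≈Q′ ρ)
  ≈⇒≋ (cong∨ {P} {P′} {Q} {Q′} P≈P′ Q≈Q′) ρ
    rewrite ⟦⟧-∨ ρ {P} {Q} | ⟦⟧-∨ ρ {P′} {Q′} = cong₂ _∨ʰ_ (≈⇒≋ P≈P′ ρ) (≈⇒≋ Q≈Q′ ρ)

  ≋⇒mfe≡ : ∀ n P Q → depth 𝔸 (fe 𝔸 P) < n → P ≋ Q → mfe 𝔸 P ≡ mfe 𝔸 Q
  ≋⇒mfe≡ (suc n) P Q (s≤s d) P≋Q =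
    trans (mfe-expand P)
      (trans (same-expansion (hd P) refl)
        (trans (cong (λ h → expand h Q) (P≋Q [])) (sym (mfe-expand Q))))
    where
    same-expansion : ∀ h → hd P ≡ h → expand h P ≡ expand h Q
    same-expansion Tʰ _ = refl
    same-expansion Fʰ _ = refl
    same-expansion Uʰ _ = refl
    same-expansion (atomʰ a) hd≡a = cong₂ (_◁ a ▷_)
      (≋⇒mfe≡ n _ _ (<-≤-trans (depth-≔T< P hd≡a) d) (λ ρ → P≋Q ((a , `T) ∷ ρ)))
      (≋⇒mfe≡ n _ _ (<-≤-trans (depth-≔F< P hd≡a) d) (λ ρ → P≋Q ((a , `F) ∷ ρ)))

  soundness : ∀ {P Q} → P ≈ Q → mfe 𝔸 P ≡ mfe 𝔸 Q
  soundness {P} {Q} P≈Q = ≋⇒mfe≡ _ P Q ≤-refl (≈⇒≋ P≈Q)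

  completeness : ∀ {P Q} → mfe 𝔸 P ≡ mfe 𝔸 Q → P ≈ Q
  completeness {P} {Q} mfeP≡mfeQ = begin
    P               ≈⟨ ≈⌜mfe⌝ _ P ≤-refl ⟩
    ⌜ mfe 𝔸 P ⌝     ≡⟨ cong ⌜_⌝ mfeP≡mfeQ ⟩
    ⌜ mfe 𝔸 Q ⌝     ≈⟨ ≈⌜mfe⌝ _ Q ≤-refl ⟨
    Q               ∎

theorem5p12 : (𝔸 : Atoms) → (P Q : SP 𝔸) →
    ((EqMFELU⊢_≈_ 𝔸 P Q → mfe 𝔸 P ≡ mfe 𝔸 Q) × (mfe 𝔸 P ≡ mfe 𝔸 Q → EqMFELU⊢_≈_ 𝔸 P Q))
theorem5p12 𝔸 P Q = soundness 𝔸 , completeness 𝔸
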